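{- (1) $M_\infty$ is a subgroup of $\mathrm{Aut}(T_\infty)$. (2) For every $n\ge1$, $M_n$ is a subgroup of $\mathrm{Aut}(T_n)$. (3) The map $P:M_\infty\to\mathbb{Z}_2^\times$, $\sigma\mapsto P(\sigma)$, is a group homomorphism. (4) For every $n\ge1$, the map $P:M_n\to(\mathbb{Z}/2^j\mathbb{Z})^\times$, where $j:=\lfloor(n+1)/2\rfloor$, is a group homomorphism.
   Context: $T_\infty$ is the infinite binary rooted tree whose nodes at level $m\ge0$ are the words of length $m$ over $\{a,b\}$ (root $x_0$ = empty word), with each node $w$ joined to $wa$ and $wb$; $T_n$ is the subtree of words of length $\le n$. $\mathrm{Aut}(T_\infty)$, $\mathrm{Aut}(T_n)$ are the groups of root-preserving tree automorphisms; such $\sigma$ maps $\{xa,xb\}$ onto $\{\sigma(x)a,\sigma(x)b\}$. Define $\mathrm{Par}(\sigma,x)=0$ if $\sigma(xa)=\sigma(x)a$ and $\sigma(xb)=\sigma(x)b$, and $=1$ if $\sigma(xa)=\sigma(x)b$ and $\sigma(xb)=\sigma(x)a$. For $\sigma\in\mathrm{Aut}(T_\infty)$ and a node $x$: $Q(\sigma,x):=\sum_{i\ge0}2^i\sum_{s_1,\ldots,s_i\in\{a,b\}}\mathrm{Par}(\sigma,x\,a\,s_1\,a\,s_2\cdots a\,s_i)\in\mathbb{Z}_2$ (concatenated words; the $i=0$ term is $\mathrm{Par}(\sigma,x)$), and $P(\sigma,x):=(-1)^{\mathrm{Par}(\sigma,x)}+2\sum_{t\in\{a,b\}}Q(\sigma,xbt)-2\sum_{t\in\{a,b\}}Q(\sigma,xat)\in\mathbb{Z}_2^\times$.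 For $n\ge m\ge0$, a node $x$ of length $m$ and $\tau\in\mathrm{Aut}(T_n)$, with $j:=\lfloor(n-m+1)/2\rfloor$, $P(\tau,x)\in(\mathbb{Z}/2^j\mathbb{Z})^\times$ is $P(\tilde\tau,x)\bmod 2^j$ for any extension $\tilde\tau\in\mathrm{Aut}(T_\infty)$ of $\tau$ (this is independent of the extension). $M_\infty:=\{\sigma\in\mathrm{Aut}(T_\infty): P(\sigma,x)=P(\sigma,x_0)\text{ for every node }x\}$, and for $\sigma\in M_\infty$, $P(\sigma):=P(\sigma,x_0)$. For $n\ge1$, $M_n:=\{\sigma\in\mathrm{Aut}(T_n):$ for every $m\ge0$ and every word $x$ of length $m$, $P(\sigma,x)\equiv P(\sigma,x_0)\pmod{2^{\lfloor(n-m+1)/2\rfloor}}\}$, and for $\sigma\in M_n$, $P(\sigma):=P(\sigma,x_0)\in(\mathbb{Z}/2^{\lfloor(n+1)/2\rfloor}\mathbb{Z})^\times$. -}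

module Defs where

open import Data.Bool using (Bool; true; false; if_then_else_)
open import Data.Nat as ℕ using (ℕ; zero; suc; _+_; _*_; _^_; _∸_; _≤_; ⌊_/2⌋)
open import Data.Nat.Properties using (m^n≢0)
open import Data.Integer as ℤ using (ℤ; +_; -[1+_])
open import Data.Integer.DivMod using (_%ℕ_)
open import Data.List using (List; []; _∷_; _++_; [_]; length; map; concatMap)
open import Data.Nat.ListAction using (sum)
open import Data.Product using (∃; _×_; _,_)
open import Data.Unit using (⊤)
open import Relation.Binary.PropositionalEquality using (_≡_)

Letter : Set
Letter = Bool

𝑎 𝑏 : Letter
𝑎 = false
𝑏 = true

Word : Set
Word = List Letter

T∞ : Word → Set
T∞ _ = ⊤

T : ℕ → Word → Set
T n w = length w ≤ n

-- A root-preserving tree automorphism of the rooted tree whose node set is D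
-- (D = T∞ or D = T n).  'fun' is the action on nodes, 'inv' its inverse;
-- outside D both functions carry no meaning.  The 'child' field says that the
-- children {xa, xb} of x are sent to children of σ(x), which (with
-- bijectivity and root preservation) is exactly being a tree automorphism.
record Aut (D : Word → Set) : Set where
  field
    fun   : Word → Word
    inv   : Word → Word
    root  : fun [] ≡ []
    child : ∀ x t → D (x ++ [ t ]) → ∃ λ t′ → fun (x ++ [ t ]) ≡ fun x ++ [ t′ ]
    invˡ  : ∀ x → D x → inv (fun x) ≡ x
    invʳ  : ∀ x → D x → fun (inv x) ≡ x
open Aut public

IsId : ∀ {D} → Aut D → Set
IsId {D} ρ = ∀ x → D x → fun ρ x ≡ x

IsComp : ∀ {D} → Aut D → Aut D → Aut D → Set
IsComp {D} ρ σ τ = ∀ x → D x → fun ρ x ≡ fun σ (fun τ x)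

IsInv : ∀ {D} → Aut D → Aut D → Set
IsInv {D} ρ σ = ∀ x → D x → fun ρ x ≡ inv σ x

IsSubgroup : ∀ {D} → (Aut D → Set) → Set
IsSubgroup {D} M =
  (∀ (ρ : Aut D) → IsId ρ → M ρ) ×
  (∀ (ρ σ τ : Aut D) → M σ → M τ → IsComp ρ σ τ → M ρ) ×
  (∀ (ρ σ : Aut D) → M σ → IsInv ρ σ → M ρ)

lastIsB : Word → Bool
lastIsB []          = false
lastIsB (t ∷ [])    = t
lastIsB (_ ∷ u ∷ w) = lastIsB (u ∷ w)

-- Par(σ,x) : true = 1 (σ(xa) = σ(x)b), false = 0 (σ(xa) = σ(x)a)
Par : ∀ {D} → Aut D → Word → Bool
Par σ x = lastIsB (fun σ (x ++ [ 𝑎 ]))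

bit : Bool → ℕ
bit true  = 1
bit false = 0

-- the 2^i words x a s₁ a s₂ ⋯ a sᵢ
words : Word → ℕ → List Word
words x zero    = [ x ]
words x (suc i) = concatMap (λ w → (w ++ (𝑎 ∷ 𝑎 ∷ [])) ∷ (w ++ (𝑎 ∷ 𝑏 ∷ [])) ∷ []) (words x i)

parCount : ∀ {D} → Aut D → Word → ℕ → ℕ
parCount σ x i = sum (map (λ w → bit (Par σ w)) (words x i))

-- Q(σ,x) truncated: Σ_{i<k} 2^i c i   (≡ Q(σ,x) mod 2^k)
Qtr : ∀ {D} → Aut D → Word → ℕ → ℕ
Qtr σ x zero    = 0
Qtr σ x (suc k) = Qtr σ x k + 2 ^ k * parCount σ x k

sgn : Bool → ℤ
sgn false = + 1
sgn true  = -[1+ 0 ]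

-- integer representative of P(σ,x) modulo 2^k (Q's are only needed mod 2^(k-1))
Pint : ∀ {D} → Aut D → Word → ℕ → ℤ
Pint σ x k =
  sgn (Par σ x)
  ℤ.+ (+ 2) ℤ.* (+ (Qtr σ (x ++ (𝑏 ∷ 𝑎 ∷ [])) (k ∸ 1) + Qtr σ (x ++ (𝑏 ∷ 𝑏 ∷ [])) (k ∸ 1)))
  ℤ.- (+ 2) ℤ.* (+ (Qtr σ (x ++ (𝑎 ∷ 𝑎 ∷ [])) (k ∸ 1) + Qtr σ (x ++ (𝑎 ∷ 𝑏 ∷ [])) (k ∸ 1)))

Pmod : ∀ {D} → Aut D → Word → ℕ → ℕ
Pmod σ x k = _%ℕ_ (Pint σ x k) (2 ^ k) {{m^n≢0 2 k}}

mulMod : ℕ → ℕ → ℕ → ℕ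
mulMod k u v = ℕ._%_ (u * v) (2 ^ k) {{m^n≢0 2 k}}

-- M∞ : P(σ,x) = P(σ,x₀) in ℤ₂, i.e. modulo every 2^k
M∞ : Aut T∞ → Set
M∞ σ = ∀ x k → Pmod σ x k ≡ Pmod σ [] k

M : (n : ℕ) → Aut (T n) → Set
M n σ = ∀ x → length x ≤ n →
  Pmod σ x ⌊ n ∸ length x + 1 /2⌋ ≡ Pmod σ [] ⌊ n ∸ length x + 1 /2⌋

IsHom∞ : Set
IsHom∞ = ∀ (ρ σ τ : Aut T∞) → M∞ σ → M∞ τ → IsComp ρ σ τ →
  ∀ k → Pmod ρ [] k ≡ mulMod k (Pmod σ [] k) (Pmod τ [] k)

IsHom : ℕ → Set
IsHom n = ∀ (ρ σ τ : Aut (T n)) → M n σ → M n τ → IsComp ρ σ τ →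
  Pmod ρ [] ⌊ n + 1 /2⌋ ≡ mulMod ⌊ n + 1 /2⌋ (Pmod σ [] ⌊ n + 1 /2⌋) (Pmod τ [] ⌊ n + 1 /2⌋)

-- Write Q(x) = Par(x) + 2 ΣQ(xat) (the recursion hidden in the definition of Q) and
-- P(x) = (-1)^Par(x) + 2 ΣQ(xbt) - 2 ΣQ(xat).  For ρ = σ ∘ τ one has
-- Par(ρ,x) = Par(τ,x) xor Par(σ,τx), and τ swaps the two subtrees below x exactly when
-- Par(τ,x) = 1; the subtree sums of σ are then read in swapped order, and the defect is
-- precisely P(σ,τx).  Hence, if P(σ,·) ≡ u at every node, induction on the precision k
-- gives Q(ρ,x) ≡ Q(σ,τx) + u·Q(τ,x) and P(ρ,x) ≡ u·P(τ,x) modulo 2^k.  This yields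
-- P(σ ∘ τ) = P(σ)·P(τ) and the constancy of P(ρ,·) for composites and for the identity;
-- for inverses it follows from σ ∘ σ⁻¹ = id.  On T n a node of length m only determines
-- P modulo 2^⌊(n-m+1)/2⌋, which is exactly what M n asks for, and M∞ is the
-- intersection of these conditions over all n.
module Submission where

open import Defs

open import Data.Bool using (Bool; true; false; not; _xor_)
open import Data.Bool.Properties using (¬-not)
open import Data.Integer as ℤ using (ℤ; +_; _+_; _*_; _-_; -_; ∣_∣)
import Data.Integer.Properties as ℤ
open import Data.Integer.Divisibility.Signed
open import Data.Integer.DivMod using (_%ℕ_; _/ℕ_; a≡a%ℕn+[a/ℕn]*n; n%ℕd<d)
open import Data.Integer.Tactic.RingSolver using (solve-∀)
open import Data.List using ([]; _∷_; _++_; [_]; length; map; concatMap)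
open import Data.List.Properties using (concatMap-++; map-++; length-++; ++-assoc; ∷ʳ-injectiveʳ)
open import Data.List.Reverse using (Reverse; []; _∶_∶ʳ_; reverseView)
open import Data.Nat as ℕ
  using (ℕ; zero; suc; _≤_; _<_; _≤′_; ≤′-refl; ≤′-step; _^_; ⌊_/2⌋; NonZero; s≤s; z≤n)
import Data.Nat.Divisibility as ℕ
open import Data.Nat.DivMod using (m<n⇒m%n≡m)
open import Data.Nat.ListAction using (sum)
open import Data.Nat.ListAction.Properties using (sum-++)
import Data.Nat.Properties as ℕ
import Data.Nat.Tactic.RingSolver as ℕ-Solver
open import Data.Product using (_,_; _×_; proj₁; proj₂)
open import Data.Sum using (inj₁; inj₂)
open import Data.Unit using (tt)
open import Function using (_∘_)
open import Level using (0ℓ)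
open import Relation.Binary.Bundles using (Setoid)
import Relation.Binary.Reasoning.Setoid as ≈-Reasoning
open import Relation.Binary.Structures using (IsEquivalence)
open import Relation.Binary.PropositionalEquality hiding ([_])
open import Relation.Unary using (_⊆_)

-- Congruences of integers

-- A record rather than a synonym for divisibility, so that a, b and m stay inferable.
infix 4 _≡_mod_
record _≡_mod_ (a b : ℤ) (m : ℕ) : Set where
  constructor ≡mod
  field ∣diff : + m ∣ a - b
open _≡_mod_

module _ {m : ℕ} where

  ≡-mod-reflexive : ∀ {a b} → a ≡ b → a ≡ b mod m
  ≡-mod-reflexive {a} refl = ≡mod (divides (+ 0) (ℤ.+-inverseʳ a))

  ≡-mod-refl : ∀ {a} → a ≡ a mod m
  ≡-mod-refl = ≡-mod-reflexive refl

  ≡-mod-sym : ∀ {a b} → a ≡ b mod m → b ≡ a mod m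
  ≡-mod-sym {a} {b} (≡mod a≡b) = ≡mod (subst (_ ∣_) (flip a b) (∣m⇒∣-m a≡b))
    where flip : ∀ a b → - (a - b) ≡ b - a
          flip = solve-∀

  ≡-mod-trans : ∀ {a b c} → a ≡ b mod m → b ≡ c mod m → a ≡ c mod m
  ≡-mod-trans {a} {b} {c} (≡mod a≡b) (≡mod b≡c) =
    ≡mod (subst (_ ∣_) (telescope a b c) (∣m∣n⇒∣m+n a≡b b≡c))
    where telescope : ∀ a b c → (a - b) + (b - c) ≡ a - c
          telescope = solve-∀

  ≡-mod-isEquivalence : IsEquivalence (λ a b → a ≡ b mod m)
  ≡-mod-isEquivalence = record { refl = ≡-mod-refl ; sym = ≡-mod-sym ; trans = ≡-mod-trans }

  +-cong-mod : ∀ {a b c d} → a ≡ b mod m → c ≡ d mod m → a + c ≡ b + d mod m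
  +-cong-mod {a} {b} {c} {d} (≡mod a≡b) (≡mod c≡d) =
    ≡mod (subst (_ ∣_) (interchange a b c d) (∣m∣n⇒∣m+n a≡b c≡d))
    where interchange : ∀ a b c d → (a - b) + (c - d) ≡ (a + c) - (b + d)
          interchange = solve-∀

  -‿cong-mod : ∀ {a b} → a ≡ b mod m → - a ≡ - b mod m
  -‿cong-mod {a} {b} (≡mod a≡b) = ≡mod (subst (_ ∣_) (neg-diff a b) (∣m⇒∣-m a≡b))
    where neg-diff : ∀ a b → - (a - b) ≡ - a - - b
          neg-diff = solve-∀

  *-cong-mod : ∀ {a b c d} → a ≡ b mod m → c ≡ d mod m → a * c ≡ b * d mod m
  *-cong-mod {a} {b} {c} {d} (≡mod a≡b) (≡mod c≡d) =
    ≡mod (subst (_ ∣_) (split a b c d) (∣m∣n⇒∣m+n (∣m⇒∣m*n c a≡b) (∣n⇒∣m*n b c≡d)))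
    where split : ∀ a b c d → (a - b) * c + b * (c - d) ≡ a * c - b * d
          split = solve-∀

  +-congˡ-mod : ∀ a {b c} → b ≡ c mod m → a + b ≡ a + c mod m
  +-congˡ-mod a = +-cong-mod (≡-mod-refl {a = a})

  +-congʳ-mod : ∀ c {a b} → a ≡ b mod m → a + c ≡ b + c mod m
  +-congʳ-mod c a≡b = +-cong-mod a≡b (≡-mod-refl {a = c})

  *-congˡ-mod : ∀ a {b c} → b ≡ c mod m → a * b ≡ a * c mod m
  *-congˡ-mod a = *-cong-mod (≡-mod-refl {a = a})

  +-multiple-mod : ∀ a {c} → + m ∣ c → a + c ≡ a mod m
  +-multiple-mod a {c} m∣c = ≡mod (subst (_ ∣_) (sym (cancel a c)) m∣c)
    where cancel : ∀ a c → a + c - a ≡ c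
          cancel = solve-∀

≡-mod-setoid : ℕ → Setoid 0ℓ 0ℓ
≡-mod-setoid m = record { isEquivalence = ≡-mod-isEquivalence {m} }

≡-mod-1 : ∀ a b → a ≡ b mod 1
≡-mod-1 a b = ≡mod (divides (a - b) (sym (ℤ.*-identityʳ (a - b))))

≡-mod-∣ : ∀ {d m a b} → d ℕ.∣ m → a ≡ b mod m → a ≡ b mod d
≡-mod-∣ d∣m (≡mod a≡b) = ≡mod (∣-trans (∣ᵤ⇒∣ d∣m) a≡b)

*-scale-mod : ∀ k {m a b} → a ≡ b mod m → + k * a ≡ + k * b mod k ℕ.* m
*-scale-mod k {m} {a} {b} a≡b =
  ≡mod (subst₂ _∣_ (sym (ℤ.pos-* k m)) (distrib (+ k) a b) (*-monoʳ-∣ (+ k) (∣diff a≡b)))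
  where distrib : ∀ k a b → k * (a - b) ≡ k * a - k * b
        distrib = solve-∀

module _ (m : ℕ) .{{_ : NonZero m}} where

  [a%ℕm]≡a : ∀ a → + (a %ℕ m) ≡ a mod m
  [a%ℕm]≡a a = ≡mod (divides (- (a /ℕ m)) (begin
      + r - a                  ≡⟨ cong (λ z → + r - z) (a≡a%ℕn+[a/ℕn]*n a m) ⟩
      + r - (+ r + a /ℕ m * + m) ≡⟨ cancel (+ r) (a /ℕ m) (+ m) ⟩
      - (a /ℕ m) * + m          ∎))
    where
    open ≡-Reasoning
    r = a %ℕ m
    cancel : ∀ r q m → r - (r + q * m) ≡ - q * m
    cancel = solve-∀

  remainder-unique-≤ : ∀ {r s} → r ≤ s → s < m → + r ≡ + s mod m → s ≡ r
  remainder-unique-≤ {r} {s} r≤s s<m r≡s = ℕ.≤-antisym (ℕ.m∸n≡0⇒m≤n s∸r≡0) r≤s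
    where
    m∣s∸r : m ℕ.∣ s ℕ.∸ r
    m∣s∸r = subst (m ℕ.∣_) (trans (cong ∣_∣ (ℤ.m-n≡m⊖n r s)) (ℤ.∣⊖∣-≤ r≤s)) (∣⇒∣ᵤ (∣diff r≡s))
    s∸r≡0 : s ℕ.∸ r ≡ 0
    s∸r≡0 = trans (sym (m<n⇒m%n≡m (ℕ.≤-<-trans (ℕ.m∸n≤m s r) s<m))) (ℕ.n∣m⇒m%n≡0 _ m m∣s∸r)

  remainder-unique : ∀ {r s} → r < m → s < m → + r ≡ + s mod m → r ≡ s
  remainder-unique {r} {s} r<m s<m r≡s with ℕ.≤-total r s
  ... | inj₁ r≤s = sym (remainder-unique-≤ r≤s s<m r≡s)
  ... | inj₂ s≤r = remainder-unique-≤ s≤r r<m (≡-mod-sym r≡s)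

  ≡-mod⇒%ℕ≡ : ∀ {a b} → a ≡ b mod m → a %ℕ m ≡ b %ℕ m
  ≡-mod⇒%ℕ≡ {a} {b} a≡b = remainder-unique (n%ℕd<d a m) (n%ℕd<d b m)
    (≡-mod-trans ([a%ℕm]≡a a) (≡-mod-trans a≡b (≡-mod-sym ([a%ℕm]≡a b))))

  %ℕ≡⇒≡-mod : ∀ {a b} → a %ℕ m ≡ b %ℕ m → a ≡ b mod m
  %ℕ≡⇒≡-mod {a} {b} eq =
    ≡-mod-trans (≡-mod-sym ([a%ℕm]≡a a)) (≡-mod-trans (≡-mod-reflexive (cong +_ eq)) ([a%ℕm]≡a b))

  %ℕ-of-product : ∀ {a b c} → a ≡ b * c mod m → a %ℕ m ≡ ((b %ℕ m) ℕ.* (c %ℕ m)) ℕ.% m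
  %ℕ-of-product {a} {b} {c} a≡bc = ≡-mod⇒%ℕ≡ (≡-mod-trans a≡bc (≡-mod-sym (≡-mod-trans
    (≡-mod-reflexive (ℤ.pos-* (b %ℕ m) (c %ℕ m))) (*-cong-mod ([a%ℕm]≡a b) ([a%ℕm]≡a c)))))

2^-mono-∣ : ∀ {k j} → k ≤′ j → 2 ^ k ℕ.∣ 2 ^ j
2^-mono-∣ ≤′-refl        = ℕ.∣-refl
2^-mono-∣ (≤′-step k≤j) = ℕ.∣-trans (2^-mono-∣ k≤j) (ℕ.n∣m*n 2)

2*⌊n/2⌋≤n : ∀ m → 2 ℕ.* ⌊ m /2⌋ ≤ m
2*⌊n/2⌋≤n m = ℕ.≤-trans
  (ℕ.+-monoʳ-≤ ⌊ m /2⌋ (ℕ.≤-trans (ℕ.≤-reflexive (ℕ.+-identityʳ _)) (ℕ.⌊n/2⌋≤⌈n/2⌉ m)))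
  (ℕ.≤-reflexive (ℕ.⌊n/2⌋+⌈n/2⌉≡n m))

2*m≤n⇒m≤⌊n/2⌋ : ∀ {k m} → 2 ℕ.* k ≤ m → k ≤ ⌊ m /2⌋
2*m≤n⇒m≤⌊n/2⌋ {k} {m} 2k≤m = subst (_≤ ⌊ m /2⌋) (sym (ℕ.n≡⌊n+n/2⌋ k))
  (ℕ.⌊n/2⌋-mono (subst (_≤ m) (cong (k ℕ.+_) (ℕ.+-identityʳ k)) 2k≤m))

-- The recursions for Q and P

lastIsB-snoc : ∀ w t → lastIsB (w ++ [ t ]) ≡ t
lastIsB-snoc []          t = refl
lastIsB-snoc (_ ∷ [])    t = refl
lastIsB-snoc (_ ∷ v ∷ w) t = lastIsB-snoc (v ∷ w) t

words-suc : ∀ x i → words x (suc i) ≡ words (x ++ 𝑎 ∷ 𝑎 ∷ []) i ++ words (x ++ 𝑎 ∷ 𝑏 ∷ []) i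
words-suc x zero    = refl
words-suc x (suc i) =
  trans (cong (concatMap _) (words-suc x i)) (concatMap-++ _ (words (x ++ 𝑎 ∷ 𝑎 ∷ []) i) _)

Qformula : Bool → ℤ → ℤ
Qformula p sa = + bit p + + 2 * sa

Pformula : Bool → ℤ → ℤ → ℤ
Pformula p sb sa = sgn p + + 2 * sb - + 2 * sa

Qsum : ∀ {D} → Aut D → Word → Letter → ℕ → ℤ
Qsum α y c k = + Qtr α (y ++ c ∷ 𝑎 ∷ []) k + + Qtr α (y ++ c ∷ 𝑏 ∷ []) k

module _ {D : Word → Set} (α : Aut D) where

  parCount-suc : ∀ x i →
    parCount α x (suc i) ≡ parCount α (x ++ 𝑎 ∷ 𝑎 ∷ []) i ℕ.+ parCount α (x ++ 𝑎 ∷ 𝑏 ∷ []) i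
  parCount-suc x i = trans (cong (λ ws → sum (map count ws)) (words-suc x i))
    (trans (cong sum (map-++ count (words (x ++ 𝑎 ∷ 𝑎 ∷ []) i) _))
           (sum-++ (map count (words (x ++ 𝑎 ∷ 𝑎 ∷ []) i)) _))
    where count : Word → ℕ
          count w = bit (Par α w)

  Qtr-suc-ℕ : ∀ x k →
    Qtr α x (suc k) ≡ bit (Par α x) ℕ.+ 2 ℕ.* (Qtr α (x ++ 𝑎 ∷ 𝑎 ∷ []) k ℕ.+ Qtr α (x ++ 𝑎 ∷ 𝑏 ∷ []) k)
  Qtr-suc-ℕ x zero    = ℕ.+-identityʳ _
  Qtr-suc-ℕ x (suc k) = begin
      Qtr α x (suc k) ℕ.+ 2 ^ suc k ℕ.* parCount α x (suc k)
    ≡⟨ cong₂ ℕ._+_ (Qtr-suc-ℕ x k) (cong (2 ^ suc k ℕ.*_) (parCount-suc x k)) ⟩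
      bit (Par α x) ℕ.+ 2 ℕ.* (A ℕ.+ B) ℕ.+ 2 ^ suc k ℕ.* (pa ℕ.+ pb)
    ≡⟨ regroup (bit (Par α x)) A B (2 ^ k) pa pb ⟩
      bit (Par α x) ℕ.+ 2 ℕ.* ((A ℕ.+ 2 ^ k ℕ.* pa) ℕ.+ (B ℕ.+ 2 ^ k ℕ.* pb))
    ∎
    where
    open ≡-Reasoning
    A = Qtr α (x ++ 𝑎 ∷ 𝑎 ∷ []) k
    B = Qtr α (x ++ 𝑎 ∷ 𝑏 ∷ []) k
    pa = parCount α (x ++ 𝑎 ∷ 𝑎 ∷ []) k
    pb = parCount α (x ++ 𝑎 ∷ 𝑏 ∷ []) k
    regroup : ∀ b A B t pa pb → b ℕ.+ 2 ℕ.* (A ℕ.+ B) ℕ.+ 2 ℕ.* t ℕ.* (pa ℕ.+ pb)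
                              ≡ b ℕ.+ 2 ℕ.* ((A ℕ.+ t ℕ.* pa) ℕ.+ (B ℕ.+ t ℕ.* pb))
    regroup = ℕ-Solver.solve-∀

  Qtr-suc : ∀ x k → + Qtr α x (suc k) ≡ Qformula (Par α x) (Qsum α x 𝑎 k)
  Qtr-suc x k = begin
    + Qtr α x (suc k)                       ≡⟨ cong +_ (Qtr-suc-ℕ x k) ⟩
    + (bit p ℕ.+ 2 ℕ.* (A ℕ.+ B))            ≡⟨ ℤ.pos-+ (bit p) _ ⟩
    + bit p + + (2 ℕ.* (A ℕ.+ B))            ≡⟨ cong (λ s → + bit p + s) (ℤ.pos-* 2 (A ℕ.+ B)) ⟩
    + bit p + + 2 * + (A ℕ.+ B)              ≡⟨ cong (λ s → + bit p + + 2 * s) (ℤ.pos-+ A B) ⟩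
    Qformula p (Qsum α x 𝑎 k)               ∎
    where
    open ≡-Reasoning
    p = Par α x
    A = Qtr α (x ++ 𝑎 ∷ 𝑎 ∷ []) k
    B = Qtr α (x ++ 𝑎 ∷ 𝑏 ∷ []) k

  Pint-suc : ∀ x k → Pint α x (suc k) ≡ Pformula (Par α x) (Qsum α x 𝑏 k) (Qsum α x 𝑎 k)
  Pint-suc x k = cong₂ (Pformula (Par α x))
    (ℤ.pos-+ (Qtr α (x ++ 𝑏 ∷ 𝑎 ∷ []) k) _) (ℤ.pos-+ (Qtr α (x ++ 𝑎 ∷ 𝑎 ∷ []) k) _)

-- Flipping the parity at a node by p reads the two subtree sums in swapped order;
-- this changes Q by p·P and P by the sign (-1)^p.
Qformula-xor : ∀ p q (S : Letter → ℤ) →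
  Qformula (p xor q) (S (𝑎 xor p)) ≡ Qformula q (S 𝑎) + + bit p * Pformula q (S 𝑏) (S 𝑎)
Qformula-xor false q     S = no-twist (+ bit q) (S 𝑎) (Pformula q (S 𝑏) (S 𝑎))
  where no-twist : ∀ b s t → b + + 2 * s ≡ (b + + 2 * s) + + 0 * t
        no-twist = solve-∀
Qformula-xor true  false S = twist (S 𝑎) (S 𝑏)
  where twist : ∀ sa sb → + 1 + + 2 * sb ≡ (+ 0 + + 2 * sa) + + 1 * (+ 1 + + 2 * sb - + 2 * sa)
        twist = solve-∀
Qformula-xor true  true  S = twist (S 𝑎) (S 𝑏)
  where twist : ∀ sa sb → + 0 + + 2 * sb ≡ (+ 1 + + 2 * sa) + + 1 * (- + 1 + + 2 * sb - + 2 * sa)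
        twist = solve-∀

Pformula-xor : ∀ p q (S : Letter → ℤ) →
  Pformula (p xor q) (S (𝑏 xor p)) (S (𝑎 xor p)) ≡ sgn p * Pformula q (S 𝑏) (S 𝑎)
Pformula-xor false q     S = sym (ℤ.*-identityˡ _)
Pformula-xor true  false S = twist (S 𝑎) (S 𝑏)
  where twist : ∀ sa sb → - + 1 + + 2 * sa - + 2 * sb ≡ - + 1 * (+ 1 + + 2 * sb - + 2 * sa)
        twist = solve-∀
Pformula-xor true  true  S = twist (S 𝑎) (S 𝑏)
  where twist : ∀ sa sb → + 1 + + 2 * sa - + 2 * sb ≡ - + 1 * (- + 1 + + 2 * sb - + 2 * sa)
        twist = solve-∀

sum-xor : ∀ (f : Letter → ℤ) d → f (𝑎 xor d) + f (𝑏 xor d) ≡ f 𝑎 + f 𝑏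
sum-xor f false = refl
sum-xor f true  = ℤ.+-comm (f 𝑏) (f 𝑎)

Qformula-cong : ∀ p {m s s′} → s ≡ s′ mod m → Qformula p s ≡ Qformula p s′ mod 2 ℕ.* m
Qformula-cong p s≡s′ = +-congˡ-mod (+ bit p) (*-scale-mod 2 s≡s′)

Pformula-cong : ∀ p {m sb sb′ sa sa′} → sb ≡ sb′ mod m → sa ≡ sa′ mod m →
  Pformula p sb sa ≡ Pformula p sb′ sa′ mod 2 ℕ.* m
Pformula-cong p sb≡sb′ sa≡sa′ =
  +-cong-mod (+-congˡ-mod (sgn p) (*-scale-mod 2 sb≡sb′)) (-‿cong-mod (*-scale-mod 2 sa≡sa′))

module _ {D : Word → Set} (α : Aut D) where

  Qtr-trunc : ∀ y {k j} → k ≤′ j → + Qtr α y j ≡ + Qtr α y k mod 2 ^ k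
  Qtr-trunc y ≤′-refl           = ≡-mod-refl
  Qtr-trunc y (≤′-step {j} k≤j) = ≡-mod-trans
    (≡-mod-reflexive (ℤ.pos-+ (Qtr α y j) _))
    (≡-mod-trans (+-multiple-mod (+ Qtr α y j) {+ (2 ^ j ℕ.* c)} (∣ᵤ⇒∣ 2^k∣2^jc)) (Qtr-trunc y k≤j))
    where
    c = parCount α y j
    2^k∣2^jc = ℕ.∣-trans (2^-mono-∣ k≤j) (ℕ.m∣m*n c)

  Qsum-trunc : ∀ y c {k j} → k ≤′ j → Qsum α y c j ≡ Qsum α y c k mod 2 ^ k
  Qsum-trunc y c k≤j = +-cong-mod (Qtr-trunc _ k≤j) (Qtr-trunc _ k≤j)

  Pint-trunc : ∀ x {k j} → k ≤ j → Pint α x k ≡ Pint α x j mod 2 ^ k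
  Pint-trunc x {zero}          _         = ≡-mod-1 _ _
  Pint-trunc x {suc k} {suc j} (s≤s k≤j) = begin
      Pint α x (suc k)
        ≡⟨ Pint-suc α x k ⟩
      Pformula (Par α x) (Qsum α x 𝑏 k) (Qsum α x 𝑎 k)
        ≈⟨ Pformula-cong (Par α x) (Qsum-trunc x 𝑏 k≤′j) (Qsum-trunc x 𝑎 k≤′j) ⟨
      Pformula (Par α x) (Qsum α x 𝑏 j) (Qsum α x 𝑎 j)
        ≡⟨ Pint-suc α x j ⟨
      Pint α x (suc j)
        ∎
    where
    open ≈-Reasoning (≡-mod-setoid (2 ^ suc k))
    k≤′j = ℕ.≤⇒≤′ k≤j

-- Visible precisions

-- P(α,y) mod 2^k only reads α on words of length < length y + 2k, i.e. inside T n.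
record Visible (n : ℕ) (y : Word) (k : ℕ) : Set where
  constructor visible
  field bound : length y ℕ.+ 2 ℕ.* k ≤ suc n
open Visible

precision : ℕ → Word → ℕ
precision n y = ⌊ n ℕ.∸ length y ℕ.+ 1 /2⌋

length-snoc : ∀ (y : Word) t → length (y ++ [ t ]) ≡ suc (length y)
length-snoc y t = trans (length-++ y) (ℕ.+-comm (length y) 1)

length-++-pair : ∀ (y : Word) c s → length (y ++ c ∷ s ∷ []) ≡ suc (suc (length y))
length-++-pair y c s = trans (length-++ y) (ℕ.+-comm (length y) 2)

module _ {n : ℕ} where

  visible-grandchild : ∀ x c s {k} → Visible n x (suc k) → Visible n (x ++ c ∷ s ∷ []) k
  visible-grandchild x c s {k} (visible vis) = visible (subst (_≤ suc n) (begin
      length x ℕ.+ 2 ℕ.* suc k              ≡⟨ shift (length x) k ⟩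
      suc (suc (length x)) ℕ.+ 2 ℕ.* k      ≡⟨ cong (ℕ._+ 2 ℕ.* k) (length-++-pair x c s) ⟨
      length (x ++ c ∷ s ∷ []) ℕ.+ 2 ℕ.* k  ∎) vis)
    where
    open ≡-Reasoning
    shift : ∀ l k → l ℕ.+ 2 ℕ.* suc k ≡ suc (suc l) ℕ.+ 2 ℕ.* k
    shift = ℕ-Solver.solve-∀

  visible⇒child∈T : ∀ {x k} → Visible n x (suc k) → suc (length x) ≤ n
  visible⇒child∈T {x} (visible vis) = ℕ.≤-pred (ℕ.≤-trans (ℕ.≤-reflexive (ℕ.+-comm 2 (length x)))
    (ℕ.≤-trans (ℕ.+-monoʳ-≤ (length x) (ℕ.*-monoʳ-≤ 2 (s≤s z≤n))) vis))

  visible⇒∈T : ∀ {x k} → Visible n x (suc k) → length x ≤ n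
  visible⇒∈T vis = ℕ.<⇒≤ (visible⇒child∈T vis)

  visible⇒grandchild∈T : ∀ {x k} → Visible n x (suc (suc k)) → suc (suc (length x)) ≤ n
  visible⇒grandchild∈T {x} vis = ℕ.≤-trans (ℕ.n≤1+n _)
    (subst (λ l → suc l ≤ n) (length-++-pair x 𝑎 𝑎) (visible⇒child∈T (visible-grandchild x 𝑎 𝑎 vis)))

  visible-root : ∀ {y k} → Visible n y k → Visible n [] k
  visible-root {y} (visible vis) = visible (ℕ.≤-trans (ℕ.m≤n+m _ (length y)) vis)

  visible⇒≤1+n : ∀ {y k} → Visible n y k → k ≤ suc n
  visible⇒≤1+n {y} {k} (visible vis) = ℕ.≤-trans (ℕ.m≤m+n k _) (ℕ.≤-trans (ℕ.m≤n+m _ (length y)) vis)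

  visible⇒≤precision : ∀ {y k} → Visible n y (suc k) → suc k ≤ precision n y
  visible⇒≤precision {y} {k} vis = 2*m≤n⇒m≤⌊n/2⌋ (begin
      2 ℕ.* suc k            ≤⟨ ℕ.m+n≤o⇒m≤o∸n (2 ℕ.* suc k) bound′ ⟩
      suc n ℕ.∸ length y     ≡⟨ cong (ℕ._∸ length y) (ℕ.+-comm 1 n) ⟩
      n ℕ.+ 1 ℕ.∸ length y   ≡⟨ ℕ.+-∸-comm 1 (visible⇒∈T vis) ⟩
      n ℕ.∸ length y ℕ.+ 1   ∎)
    where
    open ℕ.≤-Reasoning
    bound′ = subst (_≤ suc n) (ℕ.+-comm (length y) _) (bound vis)

  visible-precision : ∀ {y} → length y ≤ n → Visible n y (precision n y)
  visible-precision {y} y∈T = visible (begin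
      length y ℕ.+ 2 ℕ.* precision n y      ≤⟨ ℕ.+-monoʳ-≤ (length y) (2*⌊n/2⌋≤n _) ⟩
      length y ℕ.+ (n ℕ.∸ length y ℕ.+ 1)   ≡⟨ ℕ.+-assoc (length y) _ 1 ⟨
      length y ℕ.+ (n ℕ.∸ length y) ℕ.+ 1   ≡⟨ cong (ℕ._+ 1) (ℕ.m+[n∸m]≡n y∈T) ⟩
      n ℕ.+ 1                               ≡⟨ ℕ.+-comm n 1 ⟩
      suc n                                 ∎)
    where open ℕ.≤-Reasoning

ConstantP : ∀ {D} → ℕ → Aut D → ℤ → Set
ConstantP n α u = ∀ y k → Visible n y k → Pint α y k ≡ u mod 2 ^ k

Coherent : ∀ {D} → ℕ → Aut D → Set
Coherent n α = ∀ y k → Visible n y k → Pint α y k ≡ Pint α [] k mod 2 ^ k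

module _ {D : Word → Set} {n : ℕ} where

  ConstantP⇒Coherent : ∀ {α : Aut D} {u} → ConstantP n α u → Coherent n α
  ConstantP⇒Coherent α≡u y k vis = ≡-mod-trans (α≡u y k vis) (≡-mod-sym (α≡u [] k (visible-root vis)))

  Coherent⇒ConstantP : ∀ {α : Aut D} → Coherent n α → ConstantP n α (Pint α [] (suc n))
  Coherent⇒ConstantP {α} coh y k vis = ≡-mod-trans (coh y k vis) (Pint-trunc α [] (visible⇒≤1+n vis))

-- Automorphisms

idAut : ∀ {D} → Aut D
idAut = record
  { fun = λ x → x ; inv = λ x → x ; root = refl ; child = λ _ t _ → t , refl
  ; invˡ = λ _ _ → refl ; invʳ = λ _ _ → refl }

module _ {D : Word → Set} where

  Qtr-id : ∀ y k → + Qtr (idAut {D}) y k ≡ + 0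
  Qtr-id y zero    = refl
  Qtr-id y (suc k) = trans (Qtr-suc idAut y k)
    (cong₂ Qformula (lastIsB-snoc y 𝑎) (cong₂ _+_ (Qtr-id _ k) (Qtr-id _ k)))

  Qsum-id : ∀ y c k → Qsum (idAut {D}) y c k ≡ + 0
  Qsum-id y c k = cong₂ _+_ (Qtr-id _ k) (Qtr-id _ k)

  Pint-id : ∀ y k → Pint (idAut {D}) y k ≡ + 1 mod 2 ^ k
  Pint-id y zero    = ≡-mod-1 _ _
  Pint-id y (suc k) = ≡-mod-reflexive (begin
      Pint id y (suc k)                                   ≡⟨ Pint-suc id y k ⟩
      Pformula (Par id y) (Qsum id y 𝑏 k) (Qsum id y 𝑎 k) ≡⟨ cong₂ (Pformula (Par id y)) (Qsum-id y 𝑏 k) (Qsum-id y 𝑎 k) ⟩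
      Pformula (Par id y) (+ 0) (+ 0)                     ≡⟨ cong (λ p → Pformula p (+ 0) (+ 0)) (lastIsB-snoc y 𝑎) ⟩
      + 1                                                 ∎)
    where
    open ≡-Reasoning
    id = idAut {D}

module _ {D : Word → Set} {n : ℕ} (T⊆D : T n ⊆ D) where

  snoc∈T : ∀ y t → suc (length y) ≤ n → length (y ++ [ t ]) ≤ n
  snoc∈T y t = subst (_≤ n) (sym (length-snoc y t))

  module _ (α : Aut D) where

    fun-injective : ∀ {x y} → length x ≤ n → length y ≤ n → fun α x ≡ fun α y → x ≡ y
    fun-injective {x} {y} x∈T y∈T eq =
      trans (sym (invˡ α x (T⊆D x∈T))) (trans (cong (inv α) eq) (invˡ α y (T⊆D y∈T)))

    fun-snoc-𝑎 : ∀ y → suc (length y) ≤ n → fun α (y ++ [ 𝑎 ]) ≡ fun α y ++ [ Par α y ]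
    fun-snoc-𝑎 y y< with child α y 𝑎 (T⊆D (snoc∈T y 𝑎 y<))
    ... | t , e = trans e (cong (λ s → fun α y ++ [ s ]) (sym Par≡t))
      where
      Par≡t : Par α y ≡ t
      Par≡t = trans (cong lastIsB e) (lastIsB-snoc (fun α y) t)

    fun-snoc-𝑏 : ∀ y → suc (length y) ≤ n → fun α (y ++ [ 𝑏 ]) ≡ fun α y ++ [ not (Par α y) ]
    fun-snoc-𝑏 y y< with child α y 𝑏 (T⊆D (snoc∈T y 𝑏 y<))
    ... | t , e = trans e (cong (λ s → fun α y ++ [ s ]) (¬-not t≢Par))
      where
      t≢Par : t ≢ Par α y
      t≢Par t≡Par with ∷ʳ-injectiveʳ y y (fun-injective (snoc∈T y 𝑏 y<) (snoc∈T y 𝑎 y<)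
                         (trans e (trans (cong (λ s → fun α y ++ [ s ]) t≡Par) (sym (fun-snoc-𝑎 y y<)))))
      ... | ()

    fun-snoc : ∀ y t → suc (length y) ≤ n → fun α (y ++ [ t ]) ≡ fun α y ++ [ t xor Par α y ]
    fun-snoc y false = fun-snoc-𝑎 y
    fun-snoc y true  = fun-snoc-𝑏 y

    fun-snoc₂ : ∀ x c s → suc (suc (length x)) ≤ n →
      fun α (x ++ c ∷ s ∷ []) ≡ fun α x ++ (c xor Par α x) ∷ (s xor Par α (x ++ [ c ])) ∷ []
    fun-snoc₂ x c s x<< = begin
      fun α (x ++ c ∷ s ∷ [])                         ≡⟨ cong (fun α) (++-assoc x [ c ] [ s ]) ⟨
      fun α ((x ++ [ c ]) ++ [ s ])                   ≡⟨ fun-snoc (x ++ [ c ]) s xc< ⟩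
      fun α (x ++ [ c ]) ++ [ s xor p′ ]              ≡⟨ cong (_++ [ s xor p′ ]) (fun-snoc x c (ℕ.<⇒≤ x<<)) ⟩
      (fun α x ++ [ c xor Par α x ]) ++ [ s xor p′ ]  ≡⟨ ++-assoc (fun α x) _ _ ⟩
      fun α x ++ (c xor Par α x) ∷ (s xor p′) ∷ []     ∎
      where
      open ≡-Reasoning
      p′ = Par α (x ++ [ c ])
      xc< = subst (λ l → suc l ≤ n) (sym (length-snoc x c)) x<<

    length-fun : ∀ {y} → Reverse y → length y ≤ n → length (fun α y) ≡ length y
    length-fun []             _   = cong length (root α)
    length-fun (ys ∶ rs ∶ʳ t) y∈T = begin
      length (fun α (ys ++ [ t ]))            ≡⟨ cong length (fun-snoc ys t ys<) ⟩
      length (fun α ys ++ [ t xor Par α ys ]) ≡⟨ length-snoc (fun α ys) _ ⟩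
      suc (length (fun α ys))                 ≡⟨ cong suc (length-fun rs (ℕ.<⇒≤ ys<)) ⟩
      suc (length ys)                         ≡⟨ length-snoc ys t ⟨
      length (ys ++ [ t ])                    ∎
      where
      open ≡-Reasoning
      ys< = subst (_≤ n) (length-snoc ys t) y∈T

  Par-∘ : ∀ {ρ σ τ : Aut D} → IsComp ρ σ τ → ∀ x → suc (length x) ≤ n →
    Par ρ x ≡ Par τ x xor Par σ (fun τ x)
  Par-∘ {ρ} {σ} {τ} ρ=σ∘τ x x< = begin
    lastIsB (fun ρ (x ++ [ 𝑎 ]))                          ≡⟨ cong lastIsB (ρ=σ∘τ _ (T⊆D (snoc∈T x 𝑎 x<))) ⟩
    lastIsB (fun σ (fun τ (x ++ [ 𝑎 ])))                  ≡⟨ cong (lastIsB ∘ fun σ) (fun-snoc-𝑎 τ x x<) ⟩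
    lastIsB (fun σ (fun τ x ++ [ p ]))                    ≡⟨ cong lastIsB (fun-snoc σ (fun τ x) p τx<) ⟩
    lastIsB (fun σ (fun τ x) ++ [ p xor Par σ (fun τ x) ]) ≡⟨ lastIsB-snoc (fun σ (fun τ x)) _ ⟩
    p xor Par σ (fun τ x)                                 ∎
    where
    open ≡-Reasoning
    p = Par τ x
    τx< = subst (λ l → suc l ≤ n) (sym (length-fun τ (reverseView x) (ℕ.<⇒≤ x<))) x<

  module Composition {ρ σ τ : Aut D} (ρ=σ∘τ : IsComp ρ σ τ) {u : ℤ} (σ≡u : ConstantP n σ u) where

    Par-ρ : ∀ {x k} → Visible n x (suc k) → Par ρ x ≡ Par τ x xor Par σ (fun τ x)
    Par-ρ {x} vis = Par-∘ {ρ} {σ} {τ} ρ=σ∘τ x (visible⇒child∈T vis)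

    σ≡u-at-image : ∀ {x k} → Visible n x (suc k) → Pint σ (fun τ x) (suc k) ≡ u mod 2 ^ suc k
    σ≡u-at-image {x} {k} vis = σ≡u (fun τ x) (suc k) (visible (subst (λ l → l ℕ.+ 2 ℕ.* suc k ≤ suc n)
      (sym (length-fun τ (reverseView x) (visible⇒∈T vis))) (bound vis)))

    Q-∘ : ∀ k x → Visible n x k → + Qtr ρ x k ≡ + Qtr σ (fun τ x) k + u * + Qtr τ x k mod 2 ^ k
    Qsum-∘ : ∀ k x c → Visible n x (suc k) →
      Qsum ρ x c k ≡ Qsum σ (fun τ x) (c xor Par τ x) k + u * Qsum τ x c k mod 2 ^ k

    Q-∘ zero    x _   = ≡-mod-1 _ _
    Q-∘ (suc k) x vis = begin
        + Qtr ρ x (suc k)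
          ≡⟨ Qtr-suc ρ x k ⟩
        Qformula (Par ρ x) (Qsum ρ x 𝑎 k)
          ≡⟨ cong (λ r → Qformula r (Qsum ρ x 𝑎 k)) (Par-ρ vis) ⟩
        Qformula (p xor q) (Qsum ρ x 𝑎 k)
          ≈⟨ Qformula-cong (p xor q) (Qsum-∘ k x 𝑎 vis) ⟩
        Qformula (p xor q) (S (𝑎 xor p) + u * Ta)
          ≡⟨ distrib (+ bit (p xor q)) (S (𝑎 xor p)) u Ta ⟩
        Qformula (p xor q) (S (𝑎 xor p)) + u * (+ 2 * Ta)
          ≡⟨ cong (_+ u * (+ 2 * Ta)) (Qformula-xor p q S) ⟩
        Qformula q (S 𝑎) + + bit p * Pformula q (S 𝑏) (S 𝑎) + u * (+ 2 * Ta)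
          ≡⟨ cong₂ (λ Q P → Q + + bit p * P + u * (+ 2 * Ta)) (Qtr-suc σ x′ k) (Pint-suc σ x′ k) ⟨
        + Qtr σ x′ (suc k) + + bit p * Pint σ x′ (suc k) + u * (+ 2 * Ta)
          ≈⟨ +-congʳ-mod (u * (+ 2 * Ta))
               (+-congˡ-mod (+ Qtr σ x′ (suc k)) (*-congˡ-mod (+ bit p) (σ≡u-at-image vis))) ⟩
        + Qtr σ x′ (suc k) + + bit p * u + u * (+ 2 * Ta)
          ≡⟨ factor (+ Qtr σ x′ (suc k)) (+ bit p) u Ta ⟩
        + Qtr σ x′ (suc k) + u * Qformula p Ta
          ≡⟨ cong (λ Q → + Qtr σ x′ (suc k) + u * Q) (Qtr-suc τ x k) ⟨
        + Qtr σ x′ (suc k) + u * + Qtr τ x (suc k)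
          ∎
      where
      open ≈-Reasoning (≡-mod-setoid (2 ^ suc k))
      x′ = fun τ x
      p = Par τ x
      q = Par σ x′
      S : Letter → ℤ
      S c = Qsum σ x′ c k
      Ta = Qsum τ x 𝑎 k
      distrib : ∀ b s u t → b + + 2 * (s + u * t) ≡ b + + 2 * s + u * (+ 2 * t)
      distrib = solve-∀
      factor : ∀ Q b u t → Q + b * u + u * (+ 2 * t) ≡ Q + u * (b + + 2 * t)
      factor = solve-∀

    Qsum-∘ zero    x c _   = ≡-mod-1 _ _
    Qsum-∘ (suc k) x c vis = begin
        Qsum ρ x c (suc k)
          ≈⟨ +-cong-mod (Q-∘ (suc k) (x ++ c ∷ 𝑎 ∷ []) (visible-grandchild x c 𝑎 vis))
                        (Q-∘ (suc k) (x ++ c ∷ 𝑏 ∷ []) (visible-grandchild x c 𝑏 vis)) ⟩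
        (Qσ 𝑎 + u * Qτ 𝑎) + (Qσ 𝑏 + u * Qτ 𝑏)
          ≡⟨ interchange (Qσ 𝑎) (Qσ 𝑏) u (Qτ 𝑎) (Qτ 𝑏) ⟩
        (Qσ 𝑎 + Qσ 𝑏) + u * Qsum τ x c (suc k)
          ≡⟨ cong (_+ u * Qsum τ x c (suc k)) images ⟩
        Qsum σ x′ (c xor p) (suc k) + u * Qsum τ x c (suc k)
          ∎
      where
      open ≈-Reasoning (≡-mod-setoid (2 ^ suc k))
      x′ = fun τ x
      p = Par τ x
      Qσ Qτ Qσ-below : Letter → ℤ
      Qσ s = + Qtr σ (fun τ (x ++ c ∷ s ∷ [])) (suc k)
      Qτ s = + Qtr τ (x ++ c ∷ s ∷ []) (suc k)
      Qσ-below s = + Qtr σ (x′ ++ (c xor p) ∷ s ∷ []) (suc k)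
      interchange : ∀ a b u c d → (a + u * c) + (b + u * d) ≡ (a + b) + u * (c + d)
      interchange = solve-∀
      images : Qσ 𝑎 + Qσ 𝑏 ≡ Qsum σ x′ (c xor p) (suc k)
      images = trans (cong₂ (λ w w′ → + Qtr σ w (suc k) + + Qtr σ w′ (suc k))
                       (fun-snoc₂ τ x c 𝑎 x<<) (fun-snoc₂ τ x c 𝑏 x<<))
                     (sum-xor Qσ-below (Par τ (x ++ [ c ])))
        where x<< = visible⇒grandchild∈T vis

    P-∘ : ∀ k x → Visible n x k → Pint ρ x k ≡ u * Pint τ x k mod 2 ^ k
    P-∘ zero    x _   = ≡-mod-1 _ _
    P-∘ (suc k) x vis = begin
        Pint ρ x (suc k)
          ≡⟨ Pint-suc ρ x k ⟩
        Pformula (Par ρ x) (Qsum ρ x 𝑏 k) (Qsum ρ x 𝑎 k)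
          ≡⟨ cong (λ r → Pformula r (Qsum ρ x 𝑏 k) (Qsum ρ x 𝑎 k)) (Par-ρ vis) ⟩
        Pformula (p xor q) (Qsum ρ x 𝑏 k) (Qsum ρ x 𝑎 k)
          ≈⟨ Pformula-cong (p xor q) (Qsum-∘ k x 𝑏 vis) (Qsum-∘ k x 𝑎 vis) ⟩
        Pformula (p xor q) (S (𝑏 xor p) + u * Tb) (S (𝑎 xor p) + u * Ta)
          ≡⟨ distrib (sgn (p xor q)) (S (𝑏 xor p)) (S (𝑎 xor p)) u Tb Ta ⟩
        Pformula (p xor q) (S (𝑏 xor p)) (S (𝑎 xor p)) + u * (+ 2 * Tb - + 2 * Ta)
          ≡⟨ cong (_+ u * (+ 2 * Tb - + 2 * Ta)) (Pformula-xor p q S) ⟩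
        sgn p * Pformula q (S 𝑏) (S 𝑎) + u * (+ 2 * Tb - + 2 * Ta)
          ≡⟨ cong (λ P → sgn p * P + u * (+ 2 * Tb - + 2 * Ta)) (Pint-suc σ x′ k) ⟨
        sgn p * Pint σ x′ (suc k) + u * (+ 2 * Tb - + 2 * Ta)
          ≈⟨ +-congʳ-mod (u * (+ 2 * Tb - + 2 * Ta)) (*-congˡ-mod (sgn p) (σ≡u-at-image vis)) ⟩
        sgn p * u + u * (+ 2 * Tb - + 2 * Ta)
          ≡⟨ factor (sgn p) u Tb Ta ⟩
        u * Pformula p Tb Ta
          ≡⟨ cong (u *_) (Pint-suc τ x k) ⟨
        u * Pint τ x (suc k)
          ∎
      where
      open ≈-Reasoning (≡-mod-setoid (2 ^ suc k))
      x′ = fun τ x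
      p = Par τ x
      q = Par σ x′
      S : Letter → ℤ
      S c = Qsum σ x′ c k
      Ta = Qsum τ x 𝑎 k
      Tb = Qsum τ x 𝑏 k
      distrib : ∀ e sb sa u tb ta → e + + 2 * (sb + u * tb) - + 2 * (sa + u * ta)
                                    ≡ e + + 2 * sb - + 2 * sa + u * (+ 2 * tb - + 2 * ta)
      distrib = solve-∀
      factor : ∀ e u tb ta → e * u + u * (+ 2 * tb - + 2 * ta) ≡ u * (e + + 2 * tb - + 2 * ta)
      factor = solve-∀

  ConstantP-∘ : ∀ {ρ σ τ : Aut D} {u v} → IsComp ρ σ τ → ConstantP n σ u → ConstantP n τ v →
    ConstantP n ρ (u * v)
  ConstantP-∘ {σ = σ} {τ} {u} ρ=σ∘τ σ≡u τ≡v y k vis =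
    ≡-mod-trans (P-∘ k y vis) (*-congˡ-mod u (τ≡v y k vis))
    where open Composition {σ = σ} {τ} ρ=σ∘τ σ≡u

  Coherent-inv : ∀ {ρ σ : Aut D} → Coherent n σ → IsInv ρ σ → Coherent n ρ
  Coherent-inv {ρ} {σ} coh ρ=σ⁻¹ y k vis = begin
      Pint ρ y k                       ≡⟨ ℤ.*-identityʳ (Pint ρ y k) ⟨
      Pint ρ y k * + 1                 ≈⟨ *-congˡ-mod (Pint ρ y k) (inverse [] (visible-root vis)) ⟨
      Pint ρ y k * (u * Pint ρ [] k)   ≡⟨ swap (Pint ρ y k) u (Pint ρ [] k) ⟩
      (u * Pint ρ y k) * Pint ρ [] k   ≈⟨ *-cong-mod (inverse y vis) ≡-mod-refl ⟩
      + 1 * Pint ρ [] k                ≡⟨ ℤ.*-identityˡ (Pint ρ [] k) ⟩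
      Pint ρ [] k                      ∎
    where
    open ≈-Reasoning (≡-mod-setoid (2 ^ k))
    u = Pint σ [] (suc n)
    id=σ∘ρ : IsComp idAut σ ρ
    id=σ∘ρ x x∈D = sym (trans (cong (fun σ) (ρ=σ⁻¹ x x∈D)) (invʳ σ x x∈D))
    open Composition {σ = σ} {ρ} id=σ∘ρ (Coherent⇒ConstantP {α = σ} coh)
    inverse : ∀ z → Visible n z k → u * Pint ρ z k ≡ + 1 mod 2 ^ k
    inverse z vis = ≡-mod-trans (≡-mod-sym (P-∘ k z vis)) (Pint-id z k)
    swap : ∀ a u b → a * (u * b) ≡ (u * a) * b
    swap = solve-∀

  -- The identity of Aut D need not fix words outside T n, so its P-values are not
  -- computed directly: it agrees with idAut ∘ idAut on T n.
  Coherent-subgroup : IsSubgroup (Coherent {D} n)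
  Coherent-subgroup =
      (λ ρ ρ=id → ConstantP⇒Coherent {α = ρ}
         (ConstantP-∘ {σ = idAut} {idAut} ρ=id (λ y k _ → Pint-id y k) (λ y k _ → Pint-id y k)))
    , (λ ρ σ τ cohσ cohτ ρ=σ∘τ → ConstantP⇒Coherent {α = ρ}
         (ConstantP-∘ {σ = σ} {τ} ρ=σ∘τ (Coherent⇒ConstantP {α = σ} cohσ)
                                          (Coherent⇒ConstantP {α = τ} cohτ)))
    , (λ ρ σ cohσ ρ=σ⁻¹ → Coherent-inv {ρ} {σ} cohσ ρ=σ⁻¹)

  Coherent-hom : ∀ {ρ σ τ : Aut D} {k} → Coherent n σ → IsComp ρ σ τ → Visible n [] k →
    Pint ρ [] k ≡ Pint σ [] k * Pint τ [] k mod 2 ^ k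
  Coherent-hom {σ = σ} {τ} {k} coh ρ=σ∘τ vis = ≡-mod-trans (P-∘ k [] vis)
    (*-cong-mod (≡-mod-sym (Coherent⇒ConstantP {α = σ} coh [] k vis)) (≡-mod-refl {a = Pint τ [] k}))
    where open Composition {σ = σ} {τ} ρ=σ∘τ (Coherent⇒ConstantP {α = σ} coh)

-- The subgroups M n and M∞

M⇒Coherent : ∀ {n α} → M n α → Coherent n α
M⇒Coherent         σ∈M y zero    _   = ≡-mod-1 _ _
M⇒Coherent {n} {α} σ∈M y (suc k) vis = begin
    Pint α y (suc k)   ≈⟨ Pint-trunc α y k<j ⟩
    Pint α y j         ≈⟨ ≡-mod-∣ (2^-mono-∣ (ℕ.≤⇒≤′ k<j)) agree-at-j ⟩
    Pint α [] j        ≈⟨ Pint-trunc α [] k<j ⟨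
    Pint α [] (suc k)  ∎
  where
  open ≈-Reasoning (≡-mod-setoid (2 ^ suc k))
  j = precision n y
  k<j = visible⇒≤precision vis
  agree-at-j : Pint α y j ≡ Pint α [] j mod 2 ^ j
  agree-at-j = %ℕ≡⇒≡-mod (2 ^ j) {{ℕ.m^n≢0 2 j}} (σ∈M y (visible⇒∈T vis))

Coherent⇒M : ∀ {n α} → Coherent n α → M n α
Coherent⇒M {n} coh x x∈T =
  ≡-mod⇒%ℕ≡ (2 ^ precision n x) {{ℕ.m^n≢0 2 (precision n x)}} (coh x _ (visible-precision x∈T))

M∞⇒Coherent : ∀ {α} → M∞ α → ∀ n → Coherent n α
M∞⇒Coherent σ∈M _ y k _ = %ℕ≡⇒≡-mod (2 ^ k) {{ℕ.m^n≢0 2 k}} (σ∈M y k)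

Coherent⇒M∞ : ∀ {α} → (∀ n → Coherent n α) → M∞ α
Coherent⇒M∞ coh x k =
  ≡-mod⇒%ℕ≡ (2 ^ k) {{ℕ.m^n≢0 2 k}} (coh (length x ℕ.+ 2 ℕ.* k) x k (visible (ℕ.n≤1+n _)))

IsSubgroup-resp : ∀ {D} {M N : Aut D → Set} → (∀ {α} → M α → N α) → (∀ {α} → N α → M α) →
  IsSubgroup N → IsSubgroup M
IsSubgroup-resp M⇒N N⇒M (has-id , closed-∘ , closed-inv) =
    (λ ρ ρ=id → N⇒M (has-id ρ ρ=id))
  , (λ ρ σ τ σ∈M τ∈M ρ=σ∘τ → N⇒M (closed-∘ ρ σ τ (M⇒N σ∈M) (M⇒N τ∈M) ρ=σ∘τ))
  , (λ ρ σ σ∈M ρ=σ⁻¹ → N⇒M (closed-inv ρ σ (M⇒N σ∈M) ρ=σ⁻¹))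

IsSubgroup-⋂ : ∀ {D} {I : Set} {M : I → Aut D → Set} →
  (∀ i → IsSubgroup (M i)) → IsSubgroup (λ α → ∀ i → M i α)
IsSubgroup-⋂ sub =
    (λ ρ ρ=id i → proj₁ (sub i) ρ ρ=id)
  , (λ ρ σ τ σ∈M τ∈M ρ=σ∘τ i → proj₁ (proj₂ (sub i)) ρ σ τ (σ∈M i) (τ∈M i) ρ=σ∘τ)
  , (λ ρ σ σ∈M ρ=σ⁻¹ i → proj₂ (proj₂ (sub i)) ρ σ (σ∈M i) ρ=σ⁻¹)

Pmod-mul : ∀ {D} {ρ σ τ : Aut D} k → Pint ρ [] k ≡ Pint σ [] k * Pint τ [] k mod 2 ^ k →
  Pmod ρ [] k ≡ mulMod k (Pmod σ [] k) (Pmod τ [] k)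
Pmod-mul {σ = σ} {τ} k = %ℕ-of-product (2 ^ k) {{ℕ.m^n≢0 2 k}} {b = Pint σ [] k} {Pint τ [] k}

theorem3p2 : IsSubgroup M∞
    × (∀ (n : ℕ) → 1 ≤ n → IsSubgroup (M n))
    × IsHom∞
    × (∀ (n : ℕ) → 1 ≤ n → IsHom n)
theorem3p2 =
    IsSubgroup-resp (λ {α} → M∞⇒Coherent {α}) (λ {α} → Coherent⇒M∞ {α})
      (IsSubgroup-⋂ λ n → Coherent-subgroup {n = n} λ _ → tt)
  , (λ n _ → IsSubgroup-resp (λ {α} → M⇒Coherent {n} {α}) (λ {α} → Coherent⇒M {n} {α})
      (Coherent-subgroup {n = n} λ x∈T → x∈T))
  , (λ ρ σ τ σ∈M _ ρ=σ∘τ k → Pmod-mul {ρ = ρ} {σ} {τ} k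
      (Coherent-hom {n = 2 ℕ.* k} (λ _ → tt) {ρ} {σ} {τ} {k}
        (M∞⇒Coherent {σ} σ∈M (2 ℕ.* k)) ρ=σ∘τ (visible (ℕ.n≤1+n (2 ℕ.* k)))))
  , (λ n _ ρ σ τ σ∈M _ ρ=σ∘τ → Pmod-mul {ρ = ρ} {σ} {τ} (precision n [])
      (Coherent-hom {n = n} (λ x∈T → x∈T) {ρ} {σ} {τ}
        (M⇒Coherent {n} {σ} σ∈M) ρ=σ∘τ (visible-precision z≤n)))
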